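{- Let $\langle A,\vee\rangle$ be a join-semilattice with a least element $0$, and let $I_1,I_2$ be subsemilattices of $A$. Then $A=I_1\oplus_0 I_2$ if and only if: (Abs) for all $x_1,y_1\in I_1$ and $z_2\in I_2$, $x_1\wedge(y_1\vee z_2)=x_1\wedge y_1$, and likewise with the roles of $I_1$ and $I_2$ interchanged; and (onto) $I_1\vee I_2=A$, i.e. every $x\in A$ can be written as $x=x_1\vee x_2$ with $x_1\in I_1$, $x_2\in I_2$. Moreover, if $A=I_1\oplus_0 I_2$, then $I_1$ and $I_2$ are (order) ideals of $A$, i.e. downward closed.
   Context: A join-semilattice $\langle A,\vee\rangle$ is a set with an idempotent, commutative, associative binary operation $\vee$, ordered by $a\le b$ iff $a\vee b=b$. The partial operation $a\wedge b$ denotes the infimum of $\{a,b\}$ when it exists. Convention: any equation $t_1=t_2$ involving $\wedge$ means "if either side exists, then the other also exists and they are equal". A subsemilattice is a subset closed under $\vee$. For fixed $c\in A$, $\phi_c(x_1,x_2,x)$ is the conjunction of: (dist) $x=(x\vee x_1)\wedge(x\vee x_2)$; (p1) $x_1=(x\vee x_1)\wedge(c\vee x_1)$; (p2) $x_2=(x\vee x_2)\wedge(c\vee x_2)$; (join) $x_1\vee x_2=x\vee c$. For subsemilattices $I_1,I_2$, $A=I_1\oplus_c I_2$ means all of the following hold: (Mod1) for all $x,y\in A$, $x_1\in I_1$, $x_2\in I_2$: if $x\vee c\ge x_1\vee x_2$ then $((x\vee x_1)\wedge(x\vee x_2))\vee y=(x\vee y\vee x_1)\wedge(x\vee y\vee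 x_2)$; (Mod2) for all $x,y\in A$, $x_1\in I_1$, $x_2\in I_2$: if $x\le x_1\vee x_2$ then $((x\vee x_i)\wedge(c\vee x_i))\vee y=(x\vee y\vee x_i)\wedge(c\vee y\vee x_i)$ for $i=1,2$; (Abs$_c$) for all $x_1,y_1\in I_1$, $z_2\in I_2$: $x_1\wedge(y_1\vee z_2)=x_1\wedge(y_1\vee c)$, and likewise with $I_1,I_2$ interchanged; (exi) for all $x_1\in I_1,x_2\in I_2$ there is $x\in A$ with $\phi_c(x_1,x_2,x)$; (onto$_c$) for all $x\in A$ there are $x_1\in I_1,x_2\in I_2$ with $\phi_c(x_1,x_2,x)$. Here $A=I_1\oplus_0 I_2$ is this notion with $c=0$. -}

module Defs where

open import Level using (Level; _⊔_)
open import Data.Product using (Σ; _×_; ∃; ∃-syntax; _,_)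
open import Relation.Binary.Core using (Rel)
open import Algebra.Core using (Op₂)
open import Relation.Unary using (Pred)

module SemilatticeNotions {a ℓ : Level} {A : Set a} (_≈_ : Rel A ℓ) (_∨_ : Op₂ A) where

  infix 4 _≤_ _≐_

  _≤_ : Rel A ℓ
  u ≤ v = (u ∨ v) ≈ v

  IsInf : A → A → A → Set (a ⊔ ℓ)
  IsInf u v m = (m ≤ u) × (m ≤ v) × (∀ z → z ≤ u → z ≤ v → z ≤ m)

  -- Partially defined terms: a term denotes the predicate of its possible values
  -- (empty if undefined; a single value up to ≈ otherwise, since infima are unique).
  PT : Set (Level.suc (a ⊔ ℓ))
  PT = A → Set (a ⊔ ℓ)

  val : A → PT
  val w z = Level.Lift a (z ≈ w)

  _∨ᵖ_ : PT → PT → PT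
  (D ∨ᵖ E) z = ∃[ u ] ∃[ v ] (D u × E v × (z ≈ (u ∨ v)))

  _∧ᵖ_ : PT → PT → PT
  (D ∧ᵖ E) z = ∃[ u ] ∃[ v ] (D u × E v × IsInf u v z)

  -- The paper's convention for an equation t₁ = t₂ involving ∧ :
  -- if either side exists then so does the other, and they are equal.
  _≐_ : PT → PT → Set (a ⊔ ℓ)
  D ≐ E = (∀ u → D u → ∃[ v ] (E v × (u ≈ v)))
        × (∀ v → E v → ∃[ u ] (D u × (u ≈ v)))

  module _ {p : Level} where

    Respects≈ : Pred A p → Set (a ⊔ ℓ ⊔ p)
    Respects≈ I = ∀ {x y} → x ≈ y → I x → I y

    IsSubsemilattice : Pred A p → Set (a ⊔ ℓ ⊔ p)
    IsSubsemilattice I = Respects≈ I × (∀ {x y} → I x → I y → I (x ∨ y))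

    IsDownClosed : Pred A p → Set (a ⊔ ℓ ⊔ p)
    IsDownClosed I = ∀ {x y} → x ≤ y → I y → I x

  φ : A → A → A → A → Set (a ⊔ ℓ)
  φ c x₁ x₂ x =
      (val x ≐ (val (x ∨ x₁) ∧ᵖ val (x ∨ x₂)))
    × (val x₁ ≐ (val (x ∨ x₁) ∧ᵖ val (c ∨ x₁)))
    × (val x₂ ≐ (val (x ∨ x₂) ∧ᵖ val (c ∨ x₂)))
    × ((x₁ ∨ x₂) ≈ (x ∨ c))

  module _ {p : Level} (c : A) (I₁ I₂ : Pred A p) where

    Mod1 : Set (a ⊔ ℓ ⊔ p)
    Mod1 = ∀ x y x₁ x₂ → I₁ x₁ → I₂ x₂ → (x₁ ∨ x₂) ≤ (x ∨ c) →
      ((val (x ∨ x₁) ∧ᵖ val (x ∨ x₂)) ∨ᵖ val y)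
        ≐ (val ((x ∨ y) ∨ x₁) ∧ᵖ val ((x ∨ y) ∨ x₂))

    Mod2-at : A → A → A → Set (a ⊔ ℓ)
    Mod2-at x y xᵢ =
      ((val (x ∨ xᵢ) ∧ᵖ val (c ∨ xᵢ)) ∨ᵖ val y)
        ≐ (val ((x ∨ y) ∨ xᵢ) ∧ᵖ val ((c ∨ y) ∨ xᵢ))

    Mod2 : Set (a ⊔ ℓ ⊔ p)
    Mod2 = ∀ x y x₁ x₂ → I₁ x₁ → I₂ x₂ → x ≤ (x₁ ∨ x₂) →
      Mod2-at x y x₁ × Mod2-at x y x₂

    Absᶜ : Set (a ⊔ ℓ ⊔ p)
    Absᶜ =
        (∀ x₁ y₁ z₂ → I₁ x₁ → I₁ y₁ → I₂ z₂ →
          (val x₁ ∧ᵖ val (y₁ ∨ z₂)) ≐ (val x₁ ∧ᵖ val (y₁ ∨ c)))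
      × (∀ x₂ y₂ z₁ → I₂ x₂ → I₂ y₂ → I₁ z₁ →
          (val x₂ ∧ᵖ val (y₂ ∨ z₁)) ≐ (val x₂ ∧ᵖ val (y₂ ∨ c)))

    Exi : Set (a ⊔ ℓ ⊔ p)
    Exi = ∀ x₁ x₂ → I₁ x₁ → I₂ x₂ → ∃[ x ] φ c x₁ x₂ x

    Ontoᶜ : Set (a ⊔ ℓ ⊔ p)
    Ontoᶜ = ∀ x → ∃[ x₁ ] ∃[ x₂ ] (I₁ x₁ × I₂ x₂ × φ c x₁ x₂ x)

    IsDirectSum : Set (a ⊔ ℓ ⊔ p)
    IsDirectSum = Mod1 × Mod2 × Absᶜ × Exi × Ontoᶜ

  module _ {p : Level} (I₁ I₂ : Pred A p) where

    Abs : Set (a ⊔ ℓ ⊔ p)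
    Abs =
        (∀ x₁ y₁ z₂ → I₁ x₁ → I₁ y₁ → I₂ z₂ →
          (val x₁ ∧ᵖ val (y₁ ∨ z₂)) ≐ (val x₁ ∧ᵖ val y₁))
      × (∀ x₂ y₂ z₁ → I₂ x₂ → I₂ y₂ → I₁ z₁ →
          (val x₂ ∧ᵖ val (y₂ ∨ z₁)) ≐ (val x₂ ∧ᵖ val y₂))

    Onto : Set (a ⊔ ℓ ⊔ p)
    Onto = ∀ x → ∃[ x₁ ] ∃[ x₂ ] (I₁ x₁ × I₂ x₂ × (x ≈ (x₁ ∨ x₂)))

-- With c = 0 every element xᵢ is below c ∨ xᵢ = xᵢ, so all the partial meets in
-- (Mod1), (Mod2) and φ₀ are meets of comparable elements and always exist: the two
-- modularity conditions and (exi) hold outright, φ₀(x₁, x₂, x) says no more than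
-- x = x₁ ∨ x₂, and (Abs₀) is (Abs). For down-closure, if y ≤ j ∈ I₁ and y = b₁ ∨ b₂,
-- then b₂ ≤ 0 ∨ j, so (Abs) turns b₂ = b₂ ∧ (0 ∨ j) into b₂ = b₂ ∧ 0 = 0; here
-- 0 ∈ I₂ because 0 = a₁ ∨ a₂ forces a₂ = 0.
module Submission where

open import Defs
open import Level using (Level; lift; lower)
open import Data.Product using (_×_; _,_; proj₁; swap)
open import Function.Bundles using (_⇔_; mk⇔; module Equivalence)
open import Relation.Unary using (Pred)
open import Algebra.Lattice.Bundles using (BoundedJoinSemilattice)
import Relation.Binary.Reasoning.Setoid as SetoidReasoning

module BottomDecomposition {a ℓ : Level} (L : BoundedJoinSemilattice a ℓ) where
  open BoundedJoinSemilattice L renaming (⊥ to 0L)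
  open SemilatticeNotions _≈_ _∨_
  open SetoidReasoning setoid

  ≤-resp-≈ : ∀ {x x′ y y′} → x ≈ x′ → y ≈ y′ → x ≤ y → x′ ≤ y′
  ≤-resp-≈ x≈x′ y≈y′ x≤y = trans (sym (∨-cong x≈x′ y≈y′)) (trans x≤y y≈y′)

  ≤-refl : ∀ {x} → x ≤ x
  ≤-refl {x} = idem x

  ≤-antisym : ∀ {x y} → x ≤ y → y ≤ x → x ≈ y
  ≤-antisym {x} {y} x≤y y≤x = trans (sym y≤x) (trans (comm y x) x≤y)

  ≤-trans : ∀ {x y z} → x ≤ y → y ≤ z → x ≤ z
  ≤-trans {x} {y} {z} x≤y y≤z = begin
    x ∨ z        ≈⟨ ∨-congˡ y≤z ⟨
    x ∨ (y ∨ z)  ≈⟨ assoc x y z ⟨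
    (x ∨ y) ∨ z  ≈⟨ ∨-congʳ x≤y ⟩
    y ∨ z        ≈⟨ y≤z ⟩
    z            ∎

  x≤x∨y : ∀ {x y} → x ≤ x ∨ y
  x≤x∨y {x} {y} = trans (sym (assoc x x y)) (∨-congʳ (idem x))

  y≤x∨y : ∀ {x y} → y ≤ x ∨ y
  y≤x∨y {x} {y} = ≤-resp-≈ refl (comm y x) x≤x∨y

  ≤⇒∨≈ʳ : ∀ {x y} → x ≤ y → y ∨ x ≈ y
  ≤⇒∨≈ʳ {x} {y} x≤y = trans (comm y x) x≤y

  ≤0⇒≈0 : ∀ {x} → x ≤ 0L → x ≈ 0L
  ≤0⇒≈0 {x} x≤0 = ≤-antisym x≤0 (identityˡ x)

  x∨y≈0⇒x≈0 : ∀ {x y} → x ∨ y ≈ 0L → x ≈ 0L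
  x∨y≈0⇒x≈0 x∨y≈0 = ≤0⇒≈0 (≤-resp-≈ refl x∨y≈0 x≤x∨y)

  IsInf-resp-≈ : ∀ {u u′ v v′ m m′} → u ≈ u′ → v ≈ v′ → m ≈ m′ →
                 IsInf u v m → IsInf u′ v′ m′
  IsInf-resp-≈ u≈u′ v≈v′ m≈m′ (m≤u , m≤v , greatest) =
    ≤-resp-≈ m≈m′ u≈u′ m≤u , ≤-resp-≈ m≈m′ v≈v′ m≤v ,
    λ z z≤u′ z≤v′ → ≤-resp-≈ refl m≈m′
      (greatest z (≤-resp-≈ refl (sym u≈u′) z≤u′) (≤-resp-≈ refl (sym v≈v′) z≤v′))

  IsInf-unique : ∀ {u v m m′} → IsInf u v m → IsInf u v m′ → m ≈ m′
  IsInf-unique {m = m} {m′} (m≤u , m≤v , greatest) (m′≤u , m′≤v , greatest′) =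
    ≤-antisym (greatest′ m m≤u m≤v) (greatest m′ m′≤u m′≤v)

  lower-IsInf : ∀ {u v m} → m ≤ u → v ≈ m → IsInf u v m
  lower-IsInf m≤u v≈m =
    m≤u , ≤-resp-≈ refl (sym v≈m) ≤-refl , λ z _ z≤v → ≤-resp-≈ refl v≈m z≤v

  ≤⇒IsInf : ∀ {u v} → u ≤ v → IsInf u v u
  ≤⇒IsInf u≤v = ≤-refl , u≤v , λ z z≤u _ → z≤u

  infix 4 _⇓_
  _⇓_ : PT → Carrier → Set _
  D ⇓ w = D w × (∀ z → D z → z ≈ w)

  ≐-from-⇓ : ∀ {D E w w′} → D ⇓ w → E ⇓ w′ → w ≈ w′ → D ≐ E
  ≐-from-⇓ {w = w} {w′} (Dw , D-unique) (Ew′ , E-unique) w≈w′ =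
    (λ u Du → w′ , Ew′ , trans (D-unique u Du) w≈w′) ,
    (λ v Ev → w , Dw , trans w≈w′ (sym (E-unique v Ev)))

  ≐-trans : ∀ {D E F} → D ≐ E → E ≐ F → D ≐ F
  ≐-trans (D⊆E , E⊆D) (E⊆F , F⊆E) =
    (λ u Du → let (v , Ev , u≈v) = D⊆E u Du ; (w , Fw , v≈w) = E⊆F v Ev
              in w , Fw , trans u≈v v≈w) ,
    (λ w Fw → let (v , Ev , v≈w) = F⊆E w Fw ; (u , Du , u≈v) = E⊆D v Ev
              in u , Du , trans u≈v v≈w)

  val-⇓ : ∀ {w} → val w ⇓ w
  val-⇓ = lift refl , λ z z≈w → lower z≈w

  ∧ᵖ-⇓ : ∀ {u v m} → IsInf u v m → val u ∧ᵖ val v ⇓ m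
  ∧ᵖ-⇓ {u} {v} inf = (u , v , lift refl , lift refl , inf) ,
    λ z (u′ , v′ , lift u′≈u , lift v′≈v , inf′) →
      IsInf-unique (IsInf-resp-≈ u′≈u v′≈v refl inf′) inf

  ∨ᵖ-⇓ : ∀ {D E u v} → D ⇓ u → E ⇓ v → D ∨ᵖ E ⇓ u ∨ v
  ∨ᵖ-⇓ {u = u} {v} (Du , D-unique) (Ev , E-unique) = (u , v , Du , Ev , refl) ,
    λ z (u′ , v′ , Du′ , Ev′ , z≈u′∨v′) →
      trans z≈u′∨v′ (∨-cong (D-unique u′ Du′) (E-unique v′ Ev′))

  ∧ᵖ-congʳ : ∀ {u v v′} → v ≈ v′ → val u ∧ᵖ val v ≐ val u ∧ᵖ val v′
  ∧ᵖ-congʳ v≈v′ =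
    (λ z (s , t , s≈u , lift t≈v , inf) →
       z , (s , t , s≈u , lift (trans t≈v v≈v′) , inf) , refl) ,
    (λ z (s , t , s≈u , lift t≈v′ , inf) →
       z , (s , t , s≈u , lift (trans t≈v′ (sym v≈v′)) , inf) , refl)

  [x∨u]∧[x∨v]⇓x : ∀ {x u v} → u ≤ x → v ≤ x → val (x ∨ u) ∧ᵖ val (x ∨ v) ⇓ x
  [x∨u]∧[x∨v]⇓x u≤x v≤x =
    ∧ᵖ-⇓ (lower-IsInf (≤-resp-≈ refl (sym (≤⇒∨≈ʳ u≤x)) ≤-refl) (≤⇒∨≈ʳ v≤x))

  [x∨u]∧[0∨u]⇓u : ∀ {x u} → val (x ∨ u) ∧ᵖ val (0L ∨ u) ⇓ u
  [x∨u]∧[0∨u]⇓u {x} {u} = ∧ᵖ-⇓ (lower-IsInf y≤x∨y (identityˡ u))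

  ∧ᵖ0⇒≈0 : ∀ {u v} → (val u ∧ᵖ val 0L) v → v ≈ 0L
  ∧ᵖ0⇒≈0 (_ , _ , _ , lift t≈0 , (_ , v≤t , _)) = ≤0⇒≈0 (≤-resp-≈ refl t≈0 v≤t)

  φ₀-of-∨ : ∀ {x₁ x₂ x} → x₁ ∨ x₂ ≈ x → φ 0L x₁ x₂ x
  φ₀-of-∨ {x₁} {x₂} {x} x₁∨x₂≈x =
    ≐-from-⇓ val-⇓ ([x∨u]∧[x∨v]⇓x x₁≤x x₂≤x) refl ,
    ≐-from-⇓ val-⇓ [x∨u]∧[0∨u]⇓u refl ,
    ≐-from-⇓ val-⇓ [x∨u]∧[0∨u]⇓u refl ,
    trans x₁∨x₂≈x (sym (identityʳ x))
    where
    x₁≤x : x₁ ≤ x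
    x₁≤x = ≤-resp-≈ refl x₁∨x₂≈x x≤x∨y
    x₂≤x : x₂ ≤ x
    x₂≤x = ≤-resp-≈ refl x₁∨x₂≈x y≤x∨y

  module _ {p : Level} {I₁ I₂ : Pred Carrier p} where

    Onto-swap : Onto I₁ I₂ → Onto I₂ I₁
    Onto-swap onto x = let (x₁ , x₂ , x₁∈ , x₂∈ , x≈x₁∨x₂) = onto x
                       in x₂ , x₁ , x₂∈ , x₁∈ , trans x≈x₁∨x₂ (comm x₁ x₂)

    Onto⇒0∈ : Respects≈ I₁ → Onto I₁ I₂ → I₁ 0L
    Onto⇒0∈ resp₁ onto = let (a₁ , _ , a₁∈ , _ , 0≈a₁∨a₂) = onto 0L
                         in resp₁ (x∨y≈0⇒x≈0 (sym 0≈a₁∨a₂)) a₁∈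

  module _ {p : Level} (I₁ I₂ : Pred Carrier p) where

    mod1₀ : Mod1 0L I₁ I₂
    mod1₀ x y x₁ x₂ _ _ x₁∨x₂≤x∨0 =
      ≐-from-⇓ (∨ᵖ-⇓ ([x∨u]∧[x∨v]⇓x x₁≤x x₂≤x) val-⇓)
               ([x∨u]∧[x∨v]⇓x (≤-trans x₁≤x x≤x∨y) (≤-trans x₂≤x x≤x∨y))
               refl
      where
      x₁∨x₂≤x : x₁ ∨ x₂ ≤ x
      x₁∨x₂≤x = ≤-resp-≈ refl (identityʳ x) x₁∨x₂≤x∨0
      x₁≤x : x₁ ≤ x
      x₁≤x = ≤-trans x≤x∨y x₁∨x₂≤x
      x₂≤x : x₂ ≤ x
      x₂≤x = ≤-trans y≤x∨y x₁∨x₂≤x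

    mod2₀-at : ∀ x y xᵢ → Mod2-at 0L I₁ I₂ x y xᵢ
    mod2₀-at x y xᵢ =
      ≐-from-⇓ (∨ᵖ-⇓ [x∨u]∧[0∨u]⇓u val-⇓)
               (∧ᵖ-⇓ (lower-IsInf (≤-resp-≈ refl (sym (assoc x y xᵢ)) y≤x∨y)
                                  (∨-congʳ (identityˡ y))))
               (comm xᵢ y)

    mod2₀ : Mod2 0L I₁ I₂
    mod2₀ x y x₁ x₂ _ _ _ = mod2₀-at x y x₁ , mod2₀-at x y x₂

    exi₀ : Exi 0L I₁ I₂
    exi₀ x₁ x₂ _ _ = x₁ ∨ x₂ , φ₀-of-∨ refl

    Abs₀⇔Abs : Absᶜ 0L I₁ I₂ ⇔ Abs I₁ I₂
    Abs₀⇔Abs = mk⇔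
      (λ (abs₁ , abs₂) →
         (λ x y z x∈ y∈ z∈ → ≐-trans (abs₁ x y z x∈ y∈ z∈) (∧ᵖ-congʳ (identityʳ y))) ,
         (λ x y z x∈ y∈ z∈ → ≐-trans (abs₂ x y z x∈ y∈ z∈) (∧ᵖ-congʳ (identityʳ y))))
      (λ (abs₁ , abs₂) →
         (λ x y z x∈ y∈ z∈ → ≐-trans (abs₁ x y z x∈ y∈ z∈) (∧ᵖ-congʳ (sym (identityʳ y)))) ,
         (λ x y z x∈ y∈ z∈ → ≐-trans (abs₂ x y z x∈ y∈ z∈) (∧ᵖ-congʳ (sym (identityʳ y)))))

    Onto₀⇒Onto : Ontoᶜ 0L I₁ I₂ → Onto I₁ I₂
    Onto₀⇒Onto onto₀ x with onto₀ x
    ... | x₁ , x₂ , x₁∈ , x₂∈ , (_ , _ , _ , x₁∨x₂≈x∨0) =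
      x₁ , x₂ , x₁∈ , x₂∈ , sym (trans x₁∨x₂≈x∨0 (identityʳ x))

    Onto⇒Onto₀ : Onto I₁ I₂ → Ontoᶜ 0L I₁ I₂
    Onto⇒Onto₀ onto x with onto x
    ... | x₁ , x₂ , x₁∈ , x₂∈ , x≈x₁∨x₂ = x₁ , x₂ , x₁∈ , x₂∈ , φ₀-of-∨ (sym x≈x₁∨x₂)

    Abs∧Onto⇒downClosed : Respects≈ I₁ → Respects≈ I₂ →
                          Abs I₁ I₂ → Onto I₁ I₂ → IsDownClosed I₁
    Abs∧Onto⇒downClosed resp₁ resp₂ (_ , abs₂) onto {y} {j} y≤j j∈I₁
      with onto y
    ... | b₁ , b₂ , b₁∈I₁ , b₂∈I₂ , y≈b₁∨b₂ = resp₁ (sym y≈b₁) b₁∈I₁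
      where
      b₂≤0∨j : b₂ ≤ 0L ∨ j
      b₂≤0∨j = ≤-trans (≤-resp-≈ refl (sym y≈b₁∨b₂) y≤x∨y)
                       (≤-trans y≤j (≤-resp-≈ refl (sym (identityˡ j)) ≤-refl))

      b₂≈0 : b₂ ≈ 0L
      b₂≈0 =
        let 0∈I₂ = Onto⇒0∈ resp₂ (Onto-swap onto)
            (v , v∈b₂∧0 , b₂≈v) = proj₁ (abs₂ b₂ 0L j b₂∈I₂ 0∈I₂ j∈I₁) b₂
                                        (proj₁ (∧ᵖ-⇓ (≤⇒IsInf b₂≤0∨j)))
        in trans b₂≈v (∧ᵖ0⇒≈0 v∈b₂∧0)

      y≈b₁ : y ≈ b₁
      y≈b₁ = begin
        y        ≈⟨ y≈b₁∨b₂ ⟩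
        b₁ ∨ b₂  ≈⟨ ∨-congˡ b₂≈0 ⟩
        b₁ ∨ 0L  ≈⟨ identityʳ b₁ ⟩
        b₁       ∎

theorem2 : ∀ {a ℓ p : Level} (L : BoundedJoinSemilattice a ℓ)
    (let open BoundedJoinSemilattice L renaming (⊥ to 0L))
    (let open SemilatticeNotions _≈_ _∨_)
    (I₁ I₂ : Pred Carrier p) →
    IsSubsemilattice I₁ → IsSubsemilattice I₂ →
    (IsDirectSum 0L I₁ I₂ ⇔ (Abs I₁ I₂ × Onto I₁ I₂))
    × (IsDirectSum 0L I₁ I₂ → IsDownClosed I₁ × IsDownClosed I₂)
theorem2 L I₁ I₂ (resp₁ , _) (resp₂ , _) = sum⇔Abs∧Onto , sum⇒downClosed
  where
  open BoundedJoinSemilattice L renaming (⊥ to 0L)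
  open SemilatticeNotions _≈_ _∨_
  open BottomDecomposition L
  open Equivalence

  sum⇔Abs∧Onto : IsDirectSum 0L I₁ I₂ ⇔ (Abs I₁ I₂ × Onto I₁ I₂)
  sum⇔Abs∧Onto = mk⇔
    (λ (_ , _ , abs₀ , _ , onto₀) →
       to (Abs₀⇔Abs I₁ I₂) abs₀ , Onto₀⇒Onto I₁ I₂ onto₀)
    (λ (abs , onto) →
       mod1₀ I₁ I₂ , mod2₀ I₁ I₂ , from (Abs₀⇔Abs I₁ I₂) abs ,
       exi₀ I₁ I₂ , Onto⇒Onto₀ I₁ I₂ onto)

  sum⇒downClosed : IsDirectSum 0L I₁ I₂ → IsDownClosed I₁ × IsDownClosed I₂
  sum⇒downClosed sum with to sum⇔Abs∧Onto sum
  ... | abs , onto =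
    Abs∧Onto⇒downClosed I₁ I₂ resp₁ resp₂ abs onto ,
    Abs∧Onto⇒downClosed I₂ I₁ resp₂ resp₁ (swap abs) (Onto-swap onto)
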